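{- For every integer $m\ge 0$ and $n=3\cdot 2^m$, there is a transversal design on $n$ points with three groups (each of size $2^m$) that contains neither $F^3$ nor $C_{14}$ as a subconfiguration.
   Context: A transversal design with three groups is a triple system whose point set is partitioned into three groups of equal size such that every triple has one point in each group and each pair of points from different groups lies in exactly one triple. $F^3$ is the configuration with triples $\{1,2,3\},\{3,4,5\},\{1,5,6\},\{3,6,7\}$; $C_{14}$ has triples $\{1,2,3\},\{3,4,5\},\{1,5,6\},\{2,6,7\}$. Containment means some set of triples forms an isomorphic copy (not necessarily induced). -}

module Defs where

open import Data.Nat using (ℕ; zero; suc)
open import Data.Fin using (Fin; zero; suc; _≟_)
open import Data.Product using (Σ; _×_; _,_; proj₁; proj₂)
open import Data.List using (List; []; _∷_; length; filter)
open import Data.List.Relation.Unary.All using (All)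
open import Data.List.Relation.Unary.Any using (Any)
open import Relation.Binary.PropositionalEquality using (_≡_; _≢_)
open import Relation.Nullary.Decidable using (_×-dec_)
open import Function.Definitions using (Injective)

-- Points of a transversal design with three groups of size k:
-- a point is (g , x) with g : Fin 3 its group and x : Fin k its index in the group.
-- The point set has 3 * k elements.
Point : ℕ → Set
Point k = Fin 3 × Fin k

group : ∀ {k} → Point k → Fin 3
group = proj₁

-- A triple with exactly one point in each group: the block b has point
-- (g , b g) in group g, i.e. its point set is {(0,b 0),(1,b 1),(2,b 2)}.
Block : ℕ → Set
Block k = Fin 3 → Fin k

-- a triple system on these points (a list of triples, possibly with repetitions)
TripleSystem : ℕ → Set
TripleSystem k = List (Block k)

_∈B_ : ∀ {k} → Point k → Block k → Set
(g , x) ∈B b = b g ≡ x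

infix 4 _∈B_

pairCount : ∀ {k} → TripleSystem k → Point k → Point k → ℕ
pairCount D (g , x) (h , y) =
  length (filter (λ b → (b g ≟ x) ×-dec (b h ≟ y)) D)

-- transversal design with three groups of size k: every triple has one point
-- in each group (built into Block), and each pair of points from different
-- groups lies in exactly one triple.
IsTransversalDesign : ∀ {k} → TripleSystem k → Set
IsTransversalDesign {k} D =
  (p q : Point k) → group p ≢ group q → pairCount D p q ≡ 1

IsTriple : ∀ {k} → TripleSystem k → Point k → Point k → Point k → Set
IsTriple D p q r = Any (λ b → p ∈B b × q ∈B b × r ∈B b) D

-- a configuration on points 1..7 (written 0..6) given by its list of triples
Config : Set
Config = List (Fin 7 × Fin 7 × Fin 7)

-- D contains the configuration C (not necessarily induced): an injective map
-- of the configuration's points into D's points sending every triple of C to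
-- a triple of D.
Contains : ∀ {k} → TripleSystem k → Config → Set
Contains {k} D C =
  Σ (Fin 7 → Point k) λ φ →
    Injective _≡_ _≡_ φ ×
    All (λ t → IsTriple D (φ (proj₁ t)) (φ (proj₁ (proj₂ t))) (φ (proj₂ (proj₂ t)))) C

p1 p2 p3 p4 p5 p6 p7 : Fin 7
p1 = zero
p2 = suc zero
p3 = suc (suc zero)
p4 = suc (suc (suc zero))
p5 = suc (suc (suc (suc zero)))
p6 = suc (suc (suc (suc (suc zero))))
p7 = suc (suc (suc (suc (suc (suc zero)))))

F3 : Config
F3 = (p1 , p2 , p3) ∷ (p3 , p4 , p5) ∷ (p1 , p5 , p6) ∷ (p3 , p6 , p7) ∷ []

C14 : Config
C14 = (p1 , p2 , p3) ∷ (p3 , p4 , p5) ∷ (p1 , p5 , p6) ∷ (p2 , p6 , p7) ∷ []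

module Submission where

-- Let (A , ⊕) be a Boolean group (abelian, every element its
-- own inverse) carried by Fin k.  The blocks {(0,a),(1,b),(2,a ⊕ b)} for all
-- a, b form a transversal design with three groups of size k: every block is
-- "zero-sum" (each coordinate is the sum of the other two), so a block is
-- determined by any two of its coordinates, and any two prescribed values in
-- two different groups are realised by some block.  Fin (2 ^ m) carries such a
-- group, being in bijection with Bool × … × Bool.
--
-- In a triple system whose blocks meet every group once, points on
-- a common block lie in distinct groups.  Fin 3 has only three groups, which
-- already forbids F³ in every such system.  For C₁₄ the same pigeonhole puts
-- the points 4 and 7 in one group, and in a zero-sum system the four triples
-- force their values to agree, contradicting injectivity of the embedding.

open import Defs
open import Data.Bool using (Bool; _xor_)
open import Data.Bool.Properties using (xor-comm; xor-assoc; xor-same)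
open import Data.Empty using (⊥-elim)
open import Data.Fin using (Fin; zero; suc; _≟_; remQuot; combine)
open import Data.Fin.Properties
  using (0≢1+n; suc-injective; punchOut-injective; remQuot-combine; combine-remQuot; 1↔⊤; 2↔Bool; *↔×)
open import Data.List using (length; filter; tabulate)
open import Data.List.Properties using (filter-accept; filter-reject; filter-none)
open import Data.List.Relation.Unary.All using (All; _∷_; []; lookupAny)
open import Data.List.Relation.Unary.All.Properties using (tabulate⁺)
open import Data.List.Relation.Unary.Any using (satisfied)
open import Data.Nat using (ℕ; zero; suc; _*_; _^_)
open import Data.Product using (Σ; _×_; _,_; proj₁; proj₂; uncurry)
open import Data.Unit using (⊤; tt)
open import Function using (_∘_; _↔_; Inverse)
open import Function.Definitions using (Injective)
open import Relation.Binary.PropositionalEquality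
open import Relation.Nullary using (¬_; yes; no)
open import Relation.Nullary.Decidable using (_×-dec_)
open import Relation.Unary using (Decidable)

count-unique : ∀ {n} {A : Set} {P : A → Set} (P? : Decidable P) (f : Fin n → A) (i₀ : Fin n) →
               P (f i₀) → (∀ i → P (f i) → i ≡ i₀) → length (filter P? (tabulate f)) ≡ 1
count-unique {P = P} P? f zero P₀ only = begin
  length (filter P? (tabulate f))               ≡⟨ cong length (filter-accept P? P₀) ⟩
  suc (length (filter P? (tabulate (f ∘ suc)))) ≡⟨ cong (suc ∘ length) (filter-none P? rest-rejected) ⟩
  1                                             ∎
  where
  open ≡-Reasoning
  rest-rejected : All (λ b → ¬ P b) (tabulate (f ∘ suc))
  rest-rejected = tabulate⁺ λ i → 0≢1+n ∘ sym ∘ only (suc i)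
count-unique P? f (suc i₀) P₀ only = begin
  length (filter P? (tabulate f))         ≡⟨ cong length (filter-reject P? (0≢1+n ∘ only zero)) ⟩
  length (filter P? (tabulate (f ∘ suc))) ≡⟨ count-unique P? (f ∘ suc) i₀ P₀ (λ i → suc-injective ∘ only (suc i)) ⟩
  1                                       ∎
  where open ≡-Reasoning

fin2-avoid : ∀ {u v w : Fin 2} → u ≢ w → v ≢ w → u ≡ v
fin2-avoid {zero}     {zero}                 _   _   = refl
fin2-avoid {suc zero} {suc zero}             _   _   = refl
fin2-avoid {zero}     {suc zero} {zero}      u≢w _   = ⊥-elim (u≢w refl)
fin2-avoid {zero}     {suc zero} {suc zero}  _   v≢w = ⊥-elim (v≢w refl)
fin2-avoid {suc zero} {zero}     {zero}      _   v≢w = ⊥-elim (v≢w refl)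
fin2-avoid {suc zero} {zero}     {suc zero}  u≢w _   = ⊥-elim (u≢w refl)

-- Pigeonhole in Fin 3: once two distinct values a, c are excluded, only one
-- value is left.  Removing a via punchOut reduces this to Fin 2.
fin3-avoid : ∀ {a c x y : Fin 3} → a ≢ c → x ≢ a → x ≢ c → y ≢ a → y ≢ c → x ≡ y
fin3-avoid a≢c x≢a x≢c y≢a y≢c =
  punchOut-injective (x≢a ∘ sym) (y≢a ∘ sym)
    (fin2-avoid (x≢c ∘ punchOut-injective (x≢a ∘ sym) a≢c)
                (y≢c ∘ punchOut-injective (y≢a ∘ sym) a≢c))

block-separates : ∀ {k} {p q : Point k} {b : Block k} → p ∈B b → q ∈B b → group p ≡ group q → p ≡ q
block-separates refl refl refl = refl

Spread : ∀ {k} → Point k → Point k → Point k → Set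
Spread p q r = group p ≢ group q × group q ≢ group r × group p ≢ group r

triple-spread : ∀ {k} {D : TripleSystem k} {p q r : Point k} →
                p ≢ q → q ≢ r → p ≢ r → IsTriple D p q r → Spread p q r
triple-spread p≢q q≢r p≢r t with satisfied t
... | _ , p∈b , q∈b , r∈b =
  p≢q ∘ block-separates p∈b q∈b , q≢r ∘ block-separates q∈b r∈b , p≢r ∘ block-separates p∈b r∈b

module Embedding {k} {D : TripleSystem k} {φ : Fin 7 → Point k} (φ-inj : Injective _≡_ _≡_ φ) where

  G : Fin 7 → Fin 3
  G = group ∘ φ

  spread : ∀ {i j l} → i ≢ j → j ≢ l → i ≢ l → IsTriple D (φ i) (φ j) (φ l) → Spread (φ i) (φ j) (φ l)
  spread i≢j j≢l i≢l = triple-spread (i≢j ∘ φ-inj) (j≢l ∘ φ-inj) (i≢l ∘ φ-inj)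

  -- The triples {1,2,3},{3,4,5},{1,5,6}, shared by F³ and C₁₄: the points
  -- 1, 3, 5 occupy all three groups, and 6, avoiding the groups of 1 and 5,
  -- lies in the group of 3.
  group₆≡group₃ : IsTriple D (φ p1) (φ p2) (φ p3) → IsTriple D (φ p3) (φ p4) (φ p5) →
                  IsTriple D (φ p1) (φ p5) (φ p6) → G p6 ≡ G p3
  group₆≡group₃ t123 t345 t156 = fin3-avoid G₁≢G₅ (G₁≢G₆ ∘ sym) (G₅≢G₆ ∘ sym) (G₁≢G₃ ∘ sym) G₃≢G₅
    where
    G₁≢G₃ : G p1 ≢ G p3
    G₁≢G₃ = proj₂ (proj₂ (spread (λ ()) (λ ()) (λ ()) t123))
    G₃≢G₅ : G p3 ≢ G p5
    G₃≢G₅ = proj₂ (proj₂ (spread (λ ()) (λ ()) (λ ()) t345))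
    s156 : Spread (φ p1) (φ p5) (φ p6)
    s156 = spread (λ ()) (λ ()) (λ ()) t156
    G₁≢G₅ : G p1 ≢ G p5
    G₁≢G₅ = proj₁ s156
    G₅≢G₆ : G p5 ≢ G p6
    G₅≢G₆ = proj₁ (proj₂ s156)
    G₁≢G₆ : G p1 ≢ G p6
    G₁≢G₆ = proj₂ (proj₂ s156)

  -- In an embedding of C₁₄ the points 4 and 7 both avoid the groups of 3
  -- and 5 (for 7: since 2 and 6 sit in the groups of 5 and 3), hence share
  -- the group of 1.
  c14-sameGroup : IsTriple D (φ p1) (φ p2) (φ p3) → IsTriple D (φ p3) (φ p4) (φ p5) →
                  IsTriple D (φ p1) (φ p5) (φ p6) → IsTriple D (φ p2) (φ p6) (φ p7) → G p4 ≡ G p7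
  c14-sameGroup t123 t345 t156 t267 = trans G₄≡G₁ (sym G₇≡G₁)
    where
    s123 : Spread (φ p1) (φ p2) (φ p3)
    s123 = spread (λ ()) (λ ()) (λ ()) t123
    s345 : Spread (φ p3) (φ p4) (φ p5)
    s345 = spread (λ ()) (λ ()) (λ ()) t345
    s267 : Spread (φ p2) (φ p6) (φ p7)
    s267 = spread (λ ()) (λ ()) (λ ()) t267
    G₁≢G₃ : G p1 ≢ G p3
    G₁≢G₃ = proj₂ (proj₂ s123)
    G₁≢G₅ : G p1 ≢ G p5
    G₁≢G₅ = proj₁ (spread (λ ()) (λ ()) (λ ()) t156)
    G₃≢G₅ : G p3 ≢ G p5
    G₃≢G₅ = proj₂ (proj₂ s345)
    G₆≡G₃ : G p6 ≡ G p3
    G₆≡G₃ = group₆≡group₃ t123 t345 t156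
    G₂≡G₅ : G p2 ≡ G p5
    G₂≡G₅ = fin3-avoid G₁≢G₃ (proj₁ s123 ∘ sym) (proj₁ (proj₂ s123)) (G₁≢G₅ ∘ sym) (G₃≢G₅ ∘ sym)
    G₄≡G₁ : G p4 ≡ G p1
    G₄≡G₁ = fin3-avoid G₃≢G₅ (proj₁ s345 ∘ sym) (proj₁ (proj₂ s345)) G₁≢G₃ G₁≢G₅
    G₇≡G₁ : G p7 ≡ G p1
    G₇≡G₁ = fin3-avoid G₃≢G₅ (λ e → proj₁ (proj₂ s267) (trans G₆≡G₃ (sym e)))
                             (λ e → proj₂ (proj₂ s267) (trans G₂≡G₅ (sym e))) G₁≢G₃ G₁≢G₅

-- F³ embeds in no triple system with three groups: by group₆≡group₃ the
-- points 3 and 6 share a group, yet they lie on a common triple.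
noF3 : ∀ {k} (D : TripleSystem k) → ¬ Contains D F3
noF3 D (φ , φ-inj , t123 ∷ t345 ∷ t156 ∷ t367 ∷ []) =
  proj₁ (spread (λ ()) (λ ()) (λ ()) t367) (sym (group₆≡group₃ t123 t345 t156))
  where open Embedding {D = D} φ-inj

-- A Boolean group: an abelian group in which every element is its own
-- inverse, presented by the cancellation law x ⊕ (x ⊕ y) ≡ y.
record BooleanGroup (A : Set) : Set where
  field
    _⊕_      : A → A → A
    ⊕-comm   : ∀ x y → x ⊕ y ≡ y ⊕ x
    ⊕-assoc  : ∀ x y z → (x ⊕ y) ⊕ z ≡ x ⊕ (y ⊕ z)
    ⊕-cancel : ∀ x y → x ⊕ (x ⊕ y) ≡ y

  ⊕-cancelʳ : ∀ x y → (x ⊕ y) ⊕ y ≡ x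
  ⊕-cancelʳ x y = trans (⊕-comm (x ⊕ y) y) (trans (cong (y ⊕_) (⊕-comm x y)) (⊕-cancel y x))

⊤-booleanGroup : BooleanGroup ⊤
⊤-booleanGroup = record
  { _⊕_ = λ _ _ → tt ; ⊕-comm = λ _ _ → refl ; ⊕-assoc = λ _ _ _ → refl ; ⊕-cancel = λ _ _ → refl }

Bool-booleanGroup : BooleanGroup Bool
Bool-booleanGroup = record
  { _⊕_ = _xor_ ; ⊕-comm = xor-comm ; ⊕-assoc = xor-assoc
  ; ⊕-cancel = λ x y → trans (sym (xor-assoc x x y)) (cong (_xor y) (xor-same x)) }

×-booleanGroup : ∀ {A B} → BooleanGroup A → BooleanGroup B → BooleanGroup (A × B)
×-booleanGroup 𝔸 𝔹 = record
  { _⊕_      = λ { (a , b) (a′ , b′) → a A.⊕ a′ , b B.⊕ b′ }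
  ; ⊕-comm   = λ { (a , b) (a′ , b′) → cong₂ _,_ (A.⊕-comm a a′) (B.⊕-comm b b′) }
  ; ⊕-assoc  = λ { (a , b) (a′ , b′) (a″ , b″) → cong₂ _,_ (A.⊕-assoc a a′ a″) (B.⊕-assoc b b′ b″) }
  ; ⊕-cancel = λ { (a , b) (a′ , b′) → cong₂ _,_ (A.⊕-cancel a a′) (B.⊕-cancel b b′) }
  }
  where
  module A = BooleanGroup 𝔸
  module B = BooleanGroup 𝔹

transport : ∀ {A B} → A ↔ B → BooleanGroup B → BooleanGroup A
transport {A} A↔B 𝔹 = record
  { _⊕_ = _⊕′_
  ; ⊕-comm = λ x y → cong from (⊕-comm (to x) (to y))
  ; ⊕-assoc = λ x y z → cong from (begin
      to (from (to x ⊕ to y)) ⊕ to z ≡⟨ cong (_⊕ to z) (strictlyInverseˡ _) ⟩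
      (to x ⊕ to y) ⊕ to z           ≡⟨ ⊕-assoc (to x) (to y) (to z) ⟩
      to x ⊕ (to y ⊕ to z)           ≡⟨ cong (to x ⊕_) (strictlyInverseˡ _) ⟨
      to x ⊕ to (from (to y ⊕ to z)) ∎)
  ; ⊕-cancel = λ x y → begin
      from (to x ⊕ to (from (to x ⊕ to y))) ≡⟨ cong (λ z → from (to x ⊕ z)) (strictlyInverseˡ _) ⟩
      from (to x ⊕ (to x ⊕ to y))           ≡⟨ cong from (⊕-cancel (to x) (to y)) ⟩
      from (to y)                           ≡⟨ strictlyInverseʳ y ⟩
      y                                     ∎
  }
  where
  open Inverse A↔B using (to; from; strictlyInverseˡ; strictlyInverseʳ)
  open BooleanGroup 𝔹
  open ≡-Reasoning
  _⊕′_ : A → A → A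
  x ⊕′ y = from (to x ⊕ to y)

fin-booleanGroup : ∀ m → BooleanGroup (Fin (2 ^ m))
fin-booleanGroup zero    = transport 1↔⊤ ⊤-booleanGroup
fin-booleanGroup (suc m) =
  transport *↔× (×-booleanGroup (transport 2↔Bool Bool-booleanGroup) (fin-booleanGroup m))

module ZeroSumSystems {k} (𝔹 : BooleanGroup (Fin k)) where
  open BooleanGroup 𝔹

  ZeroSum : Block k → Set
  ZeroSum b = ∀ {g h l} → g ≢ h → h ≢ l → g ≢ l → b l ≡ b g ⊕ b h

  zeroSum-unique : ∀ {b b′} → ZeroSum b → ZeroSum b′ → ∀ {g h} → g ≢ h →
                   b g ≡ b′ g → b h ≡ b′ h → ∀ c → b c ≡ b′ c
  zeroSum-unique {b} {b′} Zb Zb′ {g} {h} g≢h bg bh c with c ≟ g | c ≟ h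
  ... | yes refl | _        = bg
  ... | no _     | yes refl = bh
  ... | no c≢g   | no c≢h   = begin
    b c          ≡⟨ Zb g≢h (c≢h ∘ sym) (c≢g ∘ sym) ⟩
    b g ⊕ b h    ≡⟨ cong₂ _⊕_ bg bh ⟩
    b′ g ⊕ b′ h  ≡⟨ Zb′ g≢h (c≢h ∘ sym) (c≢g ∘ sym) ⟨
    b′ c         ∎
    where open ≡-Reasoning

  triple-sum : ∀ {D} → All ZeroSum D → ∀ {p q r : Point k} → IsTriple D p q r → Spread p q r →
               proj₂ r ≡ proj₂ p ⊕ proj₂ q
  triple-sum ZD t (g≢h , h≢l , g≢l) with lookupAny ZD t
  ... | Zb , p∈b , q∈b , r∈b = trans (sym r∈b) (trans (Zb g≢h h≢l g≢l) (cong₂ _⊕_ p∈b q∈b))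

  -- In an embedding of C₁₄ into a zero-sum system, the points 4 and 7 carry
  -- the same value: the triples give v₇ = v₂ ⊕ v₆, v₆ = v₁ ⊕ v₅,
  -- v₅ = v₃ ⊕ v₄ and v₃ = v₁ ⊕ v₂, and after substitution everything but v₄
  -- cancels.
  c14-sameValue : ∀ {D} → All ZeroSum D → ∀ {φ : Fin 7 → Point k} → Injective _≡_ _≡_ φ →
                  IsTriple D (φ p1) (φ p2) (φ p3) → IsTriple D (φ p3) (φ p4) (φ p5) →
                  IsTriple D (φ p1) (φ p5) (φ p6) → IsTriple D (φ p2) (φ p6) (φ p7) →
                  proj₂ (φ p4) ≡ proj₂ (φ p7)
  c14-sameValue {D} ZD {φ} φ-inj t123 t345 t156 t267 = sym (begin
    V p7                                   ≡⟨ v₇ ⟩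
    V p2 ⊕ V p6                            ≡⟨ cong (V p2 ⊕_) v₆ ⟩
    V p2 ⊕ (V p1 ⊕ V p5)                   ≡⟨ cong (λ z → V p2 ⊕ (V p1 ⊕ z)) v₅ ⟩
    V p2 ⊕ (V p1 ⊕ (V p3 ⊕ V p4))          ≡⟨ cong (λ z → V p2 ⊕ (V p1 ⊕ (z ⊕ V p4))) v₃ ⟩
    V p2 ⊕ (V p1 ⊕ ((V p1 ⊕ V p2) ⊕ V p4)) ≡⟨ cong (V p2 ⊕_) (⊕-assoc (V p1) (V p1 ⊕ V p2) (V p4)) ⟨
    V p2 ⊕ ((V p1 ⊕ (V p1 ⊕ V p2)) ⊕ V p4) ≡⟨ cong (λ z → V p2 ⊕ (z ⊕ V p4)) (⊕-cancel (V p1) (V p2)) ⟩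
    V p2 ⊕ (V p2 ⊕ V p4)                   ≡⟨ ⊕-cancel (V p2) (V p4) ⟩
    V p4                                   ∎)
    where
    open Embedding {D = D} φ-inj using (spread)
    open ≡-Reasoning
    V : Fin 7 → Fin k
    V = proj₂ ∘ φ
    sum-rule : ∀ {i j l} → i ≢ j → j ≢ l → i ≢ l → IsTriple D (φ i) (φ j) (φ l) → V l ≡ V i ⊕ V j
    sum-rule i≢j j≢l i≢l t = triple-sum ZD t (spread i≢j j≢l i≢l t)
    v₃ : V p3 ≡ V p1 ⊕ V p2
    v₃ = sum-rule (λ ()) (λ ()) (λ ()) t123
    v₅ : V p5 ≡ V p3 ⊕ V p4
    v₅ = sum-rule (λ ()) (λ ()) (λ ()) t345
    v₆ : V p6 ≡ V p1 ⊕ V p5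
    v₆ = sum-rule (λ ()) (λ ()) (λ ()) t156
    v₇ : V p7 ≡ V p2 ⊕ V p6
    v₇ = sum-rule (λ ()) (λ ()) (λ ()) t267

  -- C₁₄ embeds in no zero-sum system: the points 4 and 7 would share both
  -- group and value, hence coincide.
  noC14 : ∀ {D} → All ZeroSum D → ¬ Contains D C14
  noC14 ZD (φ , φ-inj , t123 ∷ t345 ∷ t156 ∷ t267 ∷ []) = p4≢p7 (φ-inj φ₄≡φ₇)
    where
    open Embedding φ-inj using (c14-sameGroup)
    φ₄≡φ₇ : φ p4 ≡ φ p7
    φ₄≡φ₇ = cong₂ _,_ (c14-sameGroup t123 t345 t156 t267) (c14-sameValue ZD φ-inj t123 t345 t156 t267)
    p4≢p7 : p4 ≢ p7
    p4≢p7 ()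

-- The design of a Boolean group on Fin k: one block {(0,a),(1,b),(2,a ⊕ b)}
-- for every pair (a , b), listed via the bijection Fin (k * k) ≅ Fin k × Fin k.
module BooleanDesign {k} (𝔹 : BooleanGroup (Fin k)) where
  open BooleanGroup 𝔹
  open ZeroSumSystems 𝔹

  block : Fin k → Fin k → Block k
  block a b zero             = a
  block a b (suc zero)       = b
  block a b (suc (suc zero)) = a ⊕ b

  pair : Fin (k * k) → Fin k × Fin k
  pair = remQuot k

  design : TripleSystem k
  design = tabulate (uncurry block ∘ pair)

  block-zeroSum : ∀ a b → ZeroSum (block a b)
  block-zeroSum a b {zero}             {suc zero}       {suc (suc zero)} _ _ _ = refl
  block-zeroSum a b {suc zero}         {zero}           {suc (suc zero)} _ _ _ = ⊕-comm a b
  block-zeroSum a b {zero}             {suc (suc zero)} {suc zero}       _ _ _ = sym (⊕-cancel a b)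
  block-zeroSum a b {suc (suc zero)}   {zero}           {suc zero}       _ _ _ =
    sym (trans (⊕-comm (a ⊕ b) a) (⊕-cancel a b))
  block-zeroSum a b {suc zero}         {suc (suc zero)} {zero}           _ _ _ =
    sym (trans (cong (b ⊕_) (⊕-comm a b)) (⊕-cancel b a))
  block-zeroSum a b {suc (suc zero)}   {suc zero}       {zero}           _ _ _ = sym (⊕-cancelʳ a b)
  block-zeroSum a b {zero}             {zero}           g≢h _   _   = ⊥-elim (g≢h refl)
  block-zeroSum a b {suc zero}         {suc zero}       g≢h _   _   = ⊥-elim (g≢h refl)
  block-zeroSum a b {suc (suc zero)}   {suc (suc zero)} g≢h _   _   = ⊥-elim (g≢h refl)
  block-zeroSum a b {_} {zero}             {zero}             _ h≢l _ = ⊥-elim (h≢l refl)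
  block-zeroSum a b {_} {suc zero}         {suc zero}         _ h≢l _ = ⊥-elim (h≢l refl)
  block-zeroSum a b {_} {suc (suc zero)}   {suc (suc zero)}   _ h≢l _ = ⊥-elim (h≢l refl)
  block-zeroSum a b {zero}           {_} {zero}           _ _ g≢l = ⊥-elim (g≢l refl)
  block-zeroSum a b {suc zero}       {_} {suc zero}       _ _ g≢l = ⊥-elim (g≢l refl)
  block-zeroSum a b {suc (suc zero)} {_} {suc (suc zero)} _ _ g≢l = ⊥-elim (g≢l refl)

  design-zeroSum : All ZeroSum design
  design-zeroSum = tabulate⁺ λ i → block-zeroSum (proj₁ (pair i)) (proj₂ (pair i))

  block-through : ∀ {g h} → g ≢ h → ∀ x y → Σ (Fin k × Fin k) λ (a , b) → block a b g ≡ x × block a b h ≡ y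
  block-through {zero}           {suc zero}       _ x y = (x , y) , refl , refl
  block-through {suc zero}       {zero}           _ x y = (y , x) , refl , refl
  block-through {zero}           {suc (suc zero)} _ x y = (x , x ⊕ y) , refl , ⊕-cancel x y
  block-through {suc (suc zero)} {zero}           _ x y = (y , y ⊕ x) , ⊕-cancel y x , refl
  block-through {suc zero}       {suc (suc zero)} _ x y = (y ⊕ x , x) , refl , ⊕-cancelʳ y x
  block-through {suc (suc zero)} {suc zero}       _ x y = (x ⊕ y , y) , ⊕-cancelʳ x y , refl
  block-through {zero}           {zero}           g≢h _ _ = ⊥-elim (g≢h refl)
  block-through {suc zero}       {suc zero}       g≢h _ _ = ⊥-elim (g≢h refl)
  block-through {suc (suc zero)} {suc (suc zero)} g≢h _ _ = ⊥-elim (g≢h refl)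

  -- Exactly one block passes through two points of distinct groups: it exists
  -- by block-through and is unique by zeroSum-unique at coordinates 0 and 1.
  design-isTD : IsTransversalDesign design
  design-isTD (g , x) (h , y) g≢h =
    count-unique (λ b → (b g ≟ x) ×-dec (b h ≟ y)) (uncurry block ∘ pair) (combine a₀ b₀) found only
    where
    a₀ b₀ : Fin k
    a₀ = proj₁ (proj₁ (block-through g≢h x y))
    b₀ = proj₂ (proj₁ (block-through g≢h x y))
    through : block a₀ b₀ g ≡ x × block a₀ b₀ h ≡ y
    through = proj₂ (block-through g≢h x y)
    found : uncurry block (pair (combine a₀ b₀)) g ≡ x × uncurry block (pair (combine a₀ b₀)) h ≡ y
    found = subst (λ ab → uncurry block ab g ≡ x × uncurry block ab h ≡ y) (sym (remQuot-combine a₀ b₀)) through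
    only : ∀ i → uncurry block (pair i) g ≡ x × uncurry block (pair i) h ≡ y → i ≡ combine a₀ b₀
    only i (bg , bh) = begin
      i                              ≡⟨ combine-remQuot {k} k i ⟨
      uncurry combine (pair i)       ≡⟨ cong (uncurry combine) (cong₂ _,_ (agree zero) (agree (suc zero))) ⟩
      combine a₀ b₀                  ∎
      where
      open ≡-Reasoning
      a b : Fin k
      a = proj₁ (pair i)
      b = proj₂ (pair i)
      agree : ∀ c → block a b c ≡ block a₀ b₀ c
      agree = zeroSum-unique (block-zeroSum a b) (block-zeroSum a₀ b₀) g≢h
                (trans bg (sym (proj₁ through))) (trans bh (sym (proj₂ through)))

lemma3p3 : (m : ℕ) →
    Σ (TripleSystem (2 ^ m)) λ D →
      IsTransversalDesign D × ¬ Contains D F3 × ¬ Contains D C14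
lemma3p3 m = design , design-isTD , noF3 design , noC14 design-zeroSum
  where
  open BooleanDesign (fin-booleanGroup m)
  open ZeroSumSystems (fin-booleanGroup m) using (noC14)
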